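{- For every integer $k\geq 0$ there are infinitely many $n$ such that every deterministic OBDD on $n$ variables computing the partial function $\mathtt{PartialMOD^k_n}$ has width at least $2^{k+1}$.
   Context: For $\nu\in\{0,1\}^n$ let $\#_1(\nu)$ be the number of ones in $\nu$. The partial function $\mathtt{PartialMOD^k_n}$ on $\{0,1\}^n$ is defined by $\mathtt{PartialMOD^k_n}(\nu)=1$ if $\#_1(\nu)\equiv 0 \pmod{2^{k+1}}$, $\mathtt{PartialMOD^k_n}(\nu)=0$ if $\#_1(\nu)\equiv 2^k \pmod{2^{k+1}}$, and it is undefined otherwise. A deterministic OBDD on variables $x_1,\dots,x_n$ with order $\pi$ (a permutation of $\{1,\dots,n\}$) is a leveled directed acyclic graph with levels $0,\dots,n$, a single source node at level $0$, where every node at level $j-1$ ($1\le j\le n$) has exactly one outgoing edge labelled $0$ and one labelled $1$, both going to nodes at level $j$, and the nodes at level $n$ are marked accepting or rejecting. On input $\nu$ the computation starts at the source and at step $j$ follows the edge labelled $\nu_{\pi(j)}$; the input is accepted iff the reached node at level $n$ is accepting. Its width is the maximum number of nodes in a level. It computes a partial function $f$ if it accepts every $\nu$ with $f(\nu)=1$ and rejects every $\nu$ with $f(\nu)=0$ (no requirement on undefined inputs). -}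

module Defs where

open import Data.Nat using (ℕ; zero; suc; _+_; _^_; _≤_; _<_; _⊔_; _%_; NonZero)
open import Data.Nat.Properties using (m^n≢0; ≤-trans; n≤1+n)
open import Data.Bool using (Bool; true; false; if_then_else_)
open import Data.Fin using (Fin; fromℕ<)
import Data.Fin as Fin
open import Data.Product using (_×_)
open import Data.Fin.Permutation using (Permutation′; _⟨$⟩ʳ_)
open import Data.List using (List; map; foldr; upTo)
open import Data.Maybe using (Maybe; just; nothing)
open import Relation.Binary.PropositionalEquality using (_≡_; refl; subst; sym)
open import Relation.Nullary using (yes; no)
open import Data.Nat using (_≟_)

-- An input ν ∈ {0,1}^n, with ν i the value of variable x_(i+1).
Input : ℕ → Set
Input n = Fin n → Bool

count₁ : ∀ {n} (ν : Input n) (m : ℕ) → m ≤ n → ℕ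
count₁ ν zero _ = 0
count₁ ν (suc m) p =
  (if ν (fromℕ< p) then 1 else 0) + count₁ ν m (≤-trans (n≤1+n m) p)

#₁ : ∀ {n} → Input n → ℕ
#₁ {n} ν = count₁ ν n Data.Nat.Properties.≤-refl

PartialMOD : (k n : ℕ) → Input n → Maybe Bool
PartialMOD k n ν with (#₁ ν % (2 ^ suc k)) {{m^n≢0 2 (suc k)}} ≟ 0
... | yes _ = just true
... | no _ with (#₁ ν % (2 ^ suc k)) {{m^n≢0 2 (suc k)}} ≟ 2 ^ k
...   | yes _ = just false
...   | no _ = nothing

-- Levels 0..n; level j has  size j  nodes
-- (nodes of level j are Fin (size j)); values of size beyond n are irrelevant.
-- The edges from level j to level j+1 (0 ≤ j < n) are given by δ; the step
-- j+1 reads variable π(j+1), i.e. ν (order ⟨$⟩ʳ j) in 0-based indexing.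
record OBDD (n : ℕ) : Set where
  field
    order  : Permutation′ n
    size   : ℕ → ℕ
    source : size 0 ≡ 1
    δ      : (j : ℕ) → j < n → Fin (size j) → Bool → Fin (size (suc j))
    accept : Fin (size n) → Bool

  width : ℕ
  width = foldr _⊔_ 0 (map size (upTo (suc n)))

  reach : Input n → (j : ℕ) → j ≤ n → Fin (size j)
  reach ν zero _ = subst Fin (sym source) Fin.zero
  reach ν (suc j) p =
    δ j p (reach ν j (≤-trans (n≤1+n j) p)) (ν (order ⟨$⟩ʳ fromℕ< p))

  accepts : Input n → Bool
  accepts ν = accept (reach ν n Data.Nat.Properties.≤-refl)

Computes : ∀ {n} → OBDD n → (Input n → Maybe Bool) → Set
Computes {n} B f =
  ∀ (ν : Input n) →
    (f ν ≡ just true → OBDD.accepts B ν ≡ true) × (f ν ≡ just false → OBDD.accepts B ν ≡ false)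

-- Read inputs in the order of the OBDD and count ones modulo W = 2^(k+1).  Two prefixes
-- reaching the same node whose counts differ by 2^k (mod W) contradict correctness: padding
-- both with the same block of ones makes one count ≡ 0 and the other ≡ 2^k, yet both runs
-- end in the same sink.
--
-- Say a node realises a set S of residues if each r ∈ S is the count of some prefix reaching
-- it.  Pad one such prefix with a = 0, …, W − 1 ones; if the width is below W, two paddings
-- a < a' meet W − 1 levels later, and the meeting node realises S ∪ (S + d), d = a' − a.
-- This set is strictly larger than S: otherwise S is closed under adding d, hence under
-- adding 2^k (a multiple of d is ≡ 2^k mod W), which the first observation forbids.
-- Starting from {0}, W such rounds would produce more than W residues, so for n ≥ W²
-- the width is at least W.

module Submission where

open import Defs
open import Data.Nat using (ℕ; _^_; _≤_; suc; zero; _+_; _*_; _∸_; _<_; _%_; _⊓_; _⊔_; NonZero; ≢-nonZero⁻¹; z≤n; s≤s; _<?_; _≤?_; pred; _<ᵇ_; _≟_)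
open import Data.Nat.Properties
open import Data.Nat.DivMod using (%-distribˡ-+; m%n%n≡m%n; [m+n]%n≡m%n; [m+kn]%n≡m%n; m%n<n; m%n≤n; m<n⇒m%n≡m; n%n≡0)
open import Data.Nat.Tactic.RingSolver using (solve-∀)
open import Data.Bool using (Bool; true; false; if_then_else_; _∨_)
open import Data.Bool.Properties using (∨-zeroʳ)
open import Data.Maybe using (just)
open import Data.List using (_∷_; foldr)
open import Data.List.Membership.Propositional using (_∈_)
open import Data.List.Membership.Propositional.Properties using (∈-map⁺; ∈-upTo⁺)
open import Data.List.Relation.Unary.Any using (here; there)
open import Data.Fin as Fin using (Fin; toℕ; fromℕ; fromℕ<)
open import Data.Fin.Properties using (toℕ-fromℕ; toℕ-fromℕ<; fromℕ<-toℕ; toℕ-inject₁; toℕ<n; pigeonhole)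
open import Data.Fin.Permutation using (_⟨$⟩ʳ_; _⟨$⟩ˡ_; inverseˡ)
open import Data.Product using (Σ; _×_; _,_; proj₁; proj₂; ∃; ∃₂)
open import Data.Sum using (_⊎_; inj₁; inj₂; [_,_]′)
open import Data.Empty using (⊥; ⊥-elim)
open import Function using (_∘_)
open import Relation.Binary.PropositionalEquality
open import Relation.Nullary using (yes; no; contradiction)
open import Relation.Binary.Bundles using (Setoid)
import Relation.Binary.Construct.On as On
import Relation.Binary.Reasoning.Setoid as SetoidReasoning
open import Algebra.Properties.CommutativeSemigroup +-commutativeSemigroup using (x∙yz≈y∙xz; xy∙z≈xz∙y)
open import Algebra.Properties.CommutativeMonoid.Sum +-0-commutativeMonoid using (sum; sum-init-last; sum-permute; sum-cong-≗)

bit : Bool → ℕ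
bit b = if b then 1 else 0

bit≤1 : ∀ b → bit b ≤ 1
bit≤1 true  = ≤-refl
bit≤1 false = z≤n

bit-mono : ∀ {a b} → (a ≡ true → b ≡ true) → bit a ≤ bit b
bit-mono {false} _   = z≤n
bit-mono {true}  a⇒b rewrite a⇒b refl = ≤-refl

ones : (ℕ → Bool) → ℕ → ℕ
ones f zero    = 0
ones f (suc m) = bit (f m) + ones f m

_⊆[_]_ : (ℕ → Bool) → ℕ → (ℕ → Bool) → Set
f ⊆[ m ] g = ∀ r → r < m → f r ≡ true → g r ≡ true

⊆-pred : ∀ {f g m} → f ⊆[ suc m ] g → f ⊆[ m ] g
⊆-pred f⊆g r r<m = f⊆g r (m<n⇒m<1+n r<m)

⊆-suc : ∀ {f g m} → f ⊆[ m ] g → (f m ≡ true → g m ≡ true) → f ⊆[ suc m ] g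
⊆-suc {m = m} f⊆g fm⇒gm r r<1+m with m≤n⇒m<n∨m≡n (≤-pred r<1+m)
... | inj₁ r<m  = f⊆g r r<m
... | inj₂ refl = fm⇒gm

ones≤ : ∀ f m → ones f m ≤ m
ones≤ f zero    = z≤n
ones≤ f (suc m) = +-mono-≤ (bit≤1 (f m)) (ones≤ f m)

ones-mono : ∀ {f g} m → f ⊆[ m ] g → ones f m ≤ ones g m
ones-mono zero    _   = z≤n
ones-mono (suc m) f⊆g = +-mono-≤ (bit-mono (f⊆g m ≤-refl)) (ones-mono m (⊆-pred f⊆g))

⊆⇒ones<⊎⊇ : ∀ {f g} m → f ⊆[ m ] g → ones f m < ones g m ⊎ g ⊆[ m ] f
⊆⇒ones<⊎⊇ zero _ = inj₂ λ _ ()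
⊆⇒ones<⊎⊇ {f} {g} (suc m) f⊆g with ⊆⇒ones<⊎⊇ m (⊆-pred f⊆g)
... | inj₁ fewer = inj₁ (+-mono-≤-< (bit-mono (f⊆g m ≤-refl)) fewer)
... | inj₂ g⊆f with f m in fm | g m in gm
...   | true  | _     = inj₂ (⊆-suc g⊆f λ _ → fm)
...   | false | true  = inj₁ (s≤s (ones-mono m (⊆-pred f⊆g)))
...   | false | false = inj₂ (⊆-suc g⊆f λ gm≡true → contradiction (trans (sym gm) gm≡true) λ ())

ones>0⇒∃ : ∀ f m → 0 < ones f m → ∃ λ r → r < m × f r ≡ true
ones>0⇒∃ f (suc m) pos with f m in fm
... | true  = m , ≤-refl , fm
... | false with r , r<m , fr ← ones>0⇒∃ f m pos = r , m<n⇒m<1+n r<m , fr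

ones-+ : ∀ f j t → ones f (t + j) ≡ ones (λ u → f (u + j)) t + ones f j
ones-+ f j zero    = refl
ones-+ f j (suc t) = trans (cong (bit (f (t + j)) +_) (ones-+ f j t)) (sym (+-assoc (bit (f (t + j))) _ _))

ones-cong : ∀ {f g} m → (∀ t → t < m → f t ≡ g t) → ones f m ≡ ones g m
ones-cong zero    _   = refl
ones-cong (suc m) f≗g = cong₂ _+_ (cong bit (f≗g m ≤-refl)) (ones-cong m λ t t<m → f≗g t (m<n⇒m<1+n t<m))

<⇒<ᵇ≡true : ∀ {m n} → m < n → (m <ᵇ n) ≡ true
<⇒<ᵇ≡true {zero}  {suc n} _         = refl
<⇒<ᵇ≡true {suc m} {suc n} (s≤s m<n) = <⇒<ᵇ≡true m<n

≥⇒<ᵇ≡false : ∀ {m n} → n ≤ m → (m <ᵇ n) ≡ false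
≥⇒<ᵇ≡false {n = zero}        _         = refl
≥⇒<ᵇ≡false {suc m} {suc n} (s≤s n≤m) = ≥⇒<ᵇ≡false n≤m

ones-<ᵇ : ∀ c t → ones (_<ᵇ c) t ≡ t ⊓ c
ones-<ᵇ c zero    = refl
ones-<ᵇ c (suc t) with t <? c
... | yes t<c = let open ≡-Reasoning in begin
  bit (t <ᵇ c) + ones (_<ᵇ c) t  ≡⟨ cong₂ _+_ (cong bit (<⇒<ᵇ≡true t<c)) (ones-<ᵇ c t) ⟩
  suc (t ⊓ c)                    ≡⟨ cong suc (m≤n⇒m⊓n≡m (<⇒≤ t<c)) ⟩
  suc t                          ≡⟨ m≤n⇒m⊓n≡m t<c ⟨
  suc t ⊓ c                      ∎
... | no t≮c = let open ≡-Reasoning in begin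
  bit (t <ᵇ c) + ones (_<ᵇ c) t  ≡⟨ cong₂ _+_ (cong bit (≥⇒<ᵇ≡false (≮⇒≥ t≮c))) (ones-<ᵇ c t) ⟩
  t ⊓ c                          ≡⟨ m≥n⇒m⊓n≡n (≮⇒≥ t≮c) ⟩
  c                              ≡⟨ m≥n⇒m⊓n≡n (m≤n⇒m≤1+n (≮⇒≥ t≮c)) ⟨
  suc t ⊓ c                      ∎

ones≡sum : ∀ f m → ones f m ≡ sum {m} (bit ∘ f ∘ toℕ)
ones≡sum f zero    = refl
ones≡sum f (suc m) = let open ≡-Reasoning in begin
  bit (f m) + ones f m                      ≡⟨ +-comm (bit (f m)) _ ⟩
  ones f m + bit (f m)                      ≡⟨ cong₂ _+_ (ones≡sum f m) (cong (bit ∘ f) (sym (toℕ-fromℕ m))) ⟩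
  sum {m} (g ∘ toℕ) + g (toℕ (fromℕ m))     ≡⟨ cong (_+ g (toℕ (fromℕ m))) (sum-cong-≗ {m} (cong g ∘ toℕ-inject₁)) ⟨
  sum {m} (g ∘ toℕ ∘ Fin.inject₁) + g (toℕ (fromℕ m))  ≡⟨ sum-init-last (g ∘ toℕ) ⟨
  sum {suc m} (g ∘ toℕ)                     ∎
  where
  g : ℕ → ℕ
  g = bit ∘ f

pad : (ℕ → Bool) → ℕ → ℕ → ℕ → Bool
pad b j c t = if t <ᵇ j then b t else (t ∸ j) <ᵇ c

pad-< : ∀ b c {j t} → t < j → pad b j c t ≡ b t
pad-< _ _ t<j rewrite <⇒<ᵇ≡true t<j = refl

pad-≥ : ∀ b c {j t} → j ≤ t → pad b j c t ≡ ((t ∸ j) <ᵇ c)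
pad-≥ _ _ j≤t rewrite ≥⇒<ᵇ≡false j≤t = refl

ones-pad : ∀ b j c t → ones (pad b j c) (t + j) ≡ t ⊓ c + ones b j
ones-pad b j c t = begin
  ones (pad b j c) (t + j)                               ≡⟨ ones-+ (pad b j c) j t ⟩
  ones (λ u → pad b j c (u + j)) t + ones (pad b j c) j  ≡⟨ cong₂ _+_ (ones-cong t suffix) (ones-cong j λ _ → pad-< b c) ⟩
  ones (_<ᵇ c) t + ones b j                              ≡⟨ cong (_+ ones b j) (ones-<ᵇ c t) ⟩
  t ⊓ c + ones b j                                       ∎
  where
  open ≡-Reasoning
  suffix : ∀ u → u < t → pad b j c (u + j) ≡ (u <ᵇ c)
  suffix u _ = trans (pad-≥ b c (m≤n+m j u)) (cong (_<ᵇ c) (m+n∸n≡m u j))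

∈⇒≤foldr-⊔ : ∀ {x xs} → x ∈ xs → x ≤ foldr _⊔_ 0 xs
∈⇒≤foldr-⊔ (here refl)             = m≤m⊔n _ _
∈⇒≤foldr-⊔ {xs = y ∷ _} (there x∈) = ≤-trans (∈⇒≤foldr-⊔ x∈) (m≤n⊔m y _)

_∪_ : (ℕ → Bool) → (ℕ → Bool) → ℕ → Bool
(S ∪ T) r = S r ∨ T r

∪-introˡ : ∀ {S T r} → S r ≡ true → (S ∪ T) r ≡ true
∪-introˡ Sr rewrite Sr = refl

∪-introʳ : ∀ {S T r} → T r ≡ true → (S ∪ T) r ≡ true
∪-introʳ {S} {r = r} Tr rewrite Tr = ∨-zeroʳ (S r)

∪-elim : ∀ {S T r} → (S ∪ T) r ≡ true → S r ≡ true ⊎ T r ≡ true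
∪-elim {S} {r = r} S∪Tr with S r
... | true  = inj₁ refl
... | false = inj₂ S∪Tr

extend : ∀ {n} → Input n → ℕ → Bool
extend {n} ν t with t <? n
... | yes t<n = ν (fromℕ< t<n)
... | no  _   = false

extend-toℕ : ∀ {n} (ν : Input n) i → ν i ≡ extend ν (toℕ i)
extend-toℕ {n} ν i with toℕ i <? n
... | yes i<n = cong ν (sym (fromℕ<-toℕ i i<n))
... | no  i≮n = contradiction (toℕ<n i) i≮n

count₁≡ones : ∀ {n} (ν : Input n) f → (∀ i → ν i ≡ f (toℕ i)) → ∀ m (m≤n : m ≤ n) → count₁ ν m m≤n ≡ ones f m
count₁≡ones ν f ν≗f zero    _   = refl
count₁≡ones ν f ν≗f (suc m) m<n =
  cong₂ _+_ (cong bit (trans (ν≗f _) (cong f (toℕ-fromℕ< m<n)))) (count₁≡ones ν f ν≗f m _)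

#₁≡sum : ∀ {n} (ν : Input n) → #₁ ν ≡ sum {n} (bit ∘ ν)
#₁≡sum {n} ν = begin
  #₁ ν                           ≡⟨ count₁≡ones ν (extend ν) (extend-toℕ ν) n ≤-refl ⟩
  ones (extend ν) n              ≡⟨ ones≡sum (extend ν) n ⟩
  sum {n} (bit ∘ extend ν ∘ toℕ) ≡⟨ sum-cong-≗ {n} (cong bit ∘ extend-toℕ ν) ⟨
  sum {n} (bit ∘ ν)              ∎
  where open ≡-Reasoning

parity : ∀ d → ∃ λ e → d ≡ 2 * e ⊎ d ≡ suc (2 * e)
parity zero    = 0 , inj₁ refl
parity (suc d) with parity d
... | e , inj₁ refl = e , inj₂ refl
... | e , inj₂ refl = suc e , inj₁ (cong suc (sym (+-suc e (e + 0))))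

2^k-multiple : ∀ k d → 0 < d → d < 2 ^ suc k → ∃₂ λ m q → m * d ≡ 2 ^ k + q * 2 ^ suc k
2^k-multiple k d d>0 d<2^k+1 with parity d
2^k-multiple k _ _ _ | e , inj₂ refl = 2 ^ k , e , odd (2 ^ k) e
  where
  odd : ∀ a e → a * suc (2 * e) ≡ a + e * (2 * a)
  odd = solve-∀
2^k-multiple zero _ () _ | zero , inj₁ refl
2^k-multiple zero _ _ d<2 | suc e , inj₁ refl = contradiction (*-cancelˡ-< 2 (suc e) 1 d<2) λ { (s≤s ()) }
2^k-multiple (suc k) _ d>0 d<2^k+2 | e , inj₁ refl
  with m , q , me≡ ← 2^k-multiple k e (*-cancelˡ-< 2 0 e d>0) (*-cancelˡ-< 2 e (2 ^ suc k) d<2^k+2) =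
  m , q , (begin
    m * (2 * e)                    ≡⟨ double m e ⟩
    2 * (m * e)                    ≡⟨ cong (2 *_) me≡ ⟩
    2 * (2 ^ k + q * 2 ^ suc k)    ≡⟨ double-sum (2 ^ k) q ⟩
    2 ^ suc k + q * 2 ^ suc (suc k) ∎)
  where
  open ≡-Reasoning
  double : ∀ m e → m * (2 * e) ≡ 2 * (m * e)
  double = solve-∀
  double-sum : ∀ a q → 2 * (a + q * (2 * a)) ≡ 2 * a + q * (2 * (2 * a))
  double-sum = solve-∀

module Residues (k : ℕ) where
  W h : ℕ
  W = 2 ^ suc k
  h = 2 ^ k

  instance
    W≢0 : NonZero W
    W≢0 = m^n≢0 2 (suc k)

  h<W : h < W
  h<W = subst (h <_) (cong (h +_) (sym (+-identityʳ h))) (m<m+n h (m^n>0 2 k))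

  ≈-setoid : Setoid _ _
  ≈-setoid = On.setoid (setoid ℕ) (_% W)

  open Setoid ≈-setoid public using (_≈_)
  module ≈-Reasoning = SetoidReasoning ≈-setoid

  %-≈ : ∀ x → x % W ≈ x
  %-≈ x = m%n%n≡m%n x W

  +W-≈ : ∀ x → x + W ≈ x
  +W-≈ x = [m+n]%n≡m%n x W

  +-cong-≈ : ∀ {x x' y y'} → x ≈ x' → y ≈ y' → x + y ≈ x' + y'
  +-cong-≈ {x} {x'} {y} {y'} x≈x' y≈y' =
    trans (%-distribˡ-+ x y W) (trans (cong₂ (λ a b → (a + b) % W) x≈x' y≈y') (sym (%-distribˡ-+ x' y' W)))

  Has : (ℕ → Bool) → ℕ → Set
  Has S x = S (x % W) ≡ true

  Has-≈ : ∀ {S x y} → x ≈ y → Has S x → Has S y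
  Has-≈ {S} = subst (λ z → S z ≡ true)

  Has-< : ∀ {S x} → x < W → S x ≡ true → Has S x
  Has-< {S} x<W = subst (λ z → S z ≡ true) (sym (m<n⇒m%n≡m x<W))

  complement : ∀ y → W ∸ y % W + y ≈ W
  complement y = let open ≈-Reasoning in begin
    W ∸ y % W + y        ≈⟨ +-cong-≈ {W ∸ y % W} refl (%-≈ y) ⟨
    W ∸ y % W + y % W    ≡⟨ m∸n+n≡m (m%n≤n y W) ⟩
    W                    ∎

  -- r ∈ S +ₛ d iff r − d ∈ S, with r − d taken modulo W to avoid truncated subtraction.
  _+ₛ_ : (ℕ → Bool) → ℕ → ℕ → Bool
  (S +ₛ d) r = S ((r + (W ∸ d)) % W)

  module _ {S : ℕ → Bool} {d : ℕ} (d<W : d < W) (closed : (S +ₛ d) ⊆[ W ] S) where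

    +d-closed : ∀ x → Has S x → Has S (x + d)
    +d-closed x Sx = closed ((x + d) % W) (m%n<n (x + d) W) (Has-≈ {S} x≈ Sx)
      where
      open ≈-Reasoning
      x≈ : x ≈ (x + d) % W + (W ∸ d)
      x≈ = begin
        x                        ≈⟨ +W-≈ x ⟨
        x + W                    ≡⟨ cong (x +_) (m+[n∸m]≡n (<⇒≤ d<W)) ⟨
        x + (d + (W ∸ d))        ≡⟨ +-assoc x d (W ∸ d) ⟨
        (x + d) + (W ∸ d)        ≈⟨ +-cong-≈ (%-≈ (x + d)) refl ⟨
        (x + d) % W + (W ∸ d)    ∎

    +md-closed : ∀ m x → Has S x → Has S (x + m * d)
    +md-closed zero    x Sx = Has-≈ {S} (cong (_% W) (sym (+-identityʳ x))) Sx
    +md-closed (suc m) x Sx = Has-≈ {S} (cong (_% W) x+md+d≡) (+d-closed (x + m * d) (+md-closed m x Sx))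
      where
      x+md+d≡ : x + m * d + d ≡ x + suc m * d
      x+md+d≡ = trans (+-assoc x (m * d) d) (cong (x +_) (+-comm (m * d) d))

    +h-closed : 0 < d → ∀ x → Has S x → Has S (x + h)
    +h-closed d>0 x Sx with m , q , md≡ ← 2^k-multiple k d d>0 d<W = Has-≈ {S} x+md≈ (+md-closed m x Sx)
      where
      open ≈-Reasoning
      x+md≈ : x + m * d ≈ x + h
      x+md≈ = begin
        x + m * d         ≡⟨ cong (x +_) md≡ ⟩
        x + (h + q * W)   ≡⟨ +-assoc x h (q * W) ⟨
        x + h + q * W     ≈⟨ [m+kn]%n≡m%n (x + h) q W ⟩
        x + h             ∎

  PartialMOD-true : ∀ {n} (ν : Input n) → #₁ ν % W ≡ 0 → PartialMOD k n ν ≡ just true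
  PartialMOD-true ν ≡0 with #₁ ν % W ≟ 0
  ... | yes _  = refl
  ... | no ≢0 = contradiction ≡0 ≢0

  PartialMOD-false : ∀ {n} (ν : Input n) → #₁ ν % W ≡ h → PartialMOD k n ν ≡ just false
  PartialMOD-false ν ≡h with #₁ ν % W ≟ 0
  ... | yes ≡0 = contradiction (trans (sym ≡h) ≡0) (≢-nonZero⁻¹ h {{m^n≢0 2 k}})
  ... | no _ with #₁ ν % W ≟ h
  ...   | yes _  = refl
  ...   | no ≢h = contradiction ≡h ≢h

module Runs {n} (B : OBDD n) where
  open OBDD B

  -- An input is described by the bit b t read at step t + 1; inp turns it into an assignment.
  run : (ℕ → Bool) → (j : ℕ) → j ≤ n → Fin (size j)
  run b zero    _   = subst Fin (sym source) Fin.zero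
  run b (suc j) j<n = δ j j<n (run b j (≤-trans (n≤1+n j) j<n)) (b j)

  run-irrelevant : ∀ b j (p q : j ≤ n) → run b j p ≡ run b j q
  run-irrelevant b j p q = cong (run b j) (≤-irrelevant p q)

  run-agree : ∀ {b b' j s} → j ≤ s → (j≤n : j ≤ n) (s≤n : s ≤ n) → run b j j≤n ≡ run b' j j≤n →
              (∀ t → j ≤ t → t < s → b t ≡ b' t) → run b s s≤n ≡ run b' s s≤n
  run-agree {s = zero} _ _ _ _ _ = refl
  run-agree {b} {b'} {j} {suc s} j≤1+s j≤n s<n same agree with m≤n⇒m<n∨m≡n j≤1+s
  ... | inj₁ j<1+s = cong₂ (δ s s<n) (run-agree (≤-pred j<1+s) j≤n _ same λ t j≤t t<s → agree t j≤t (m<n⇒m<1+n t<s))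
                                     (agree s (≤-pred j<1+s) ≤-refl)
  ... | inj₂ refl  = trans (run-irrelevant b j s<n j≤n) (trans same (run-irrelevant b' j j≤n s<n))

  pad-run : ∀ {b b' j s} c → j ≤ s → (j≤n : j ≤ n) (s≤n : s ≤ n) → run b j j≤n ≡ run b' j j≤n →
            run (pad b j c) s s≤n ≡ run (pad b' j c) s s≤n
  pad-run {b} {b'} {j} c j≤s j≤n s≤n same = run-agree j≤s j≤n s≤n
    (trans (run-prefix b) (trans same (sym (run-prefix b'))))
    (λ t j≤t _ → trans (pad-≥ b c j≤t) (sym (pad-≥ b' c j≤t)))
    where
    run-prefix : ∀ b → run (pad b j c) j j≤n ≡ run b j j≤n
    run-prefix b = run-agree z≤n z≤n j≤n refl λ _ _ → pad-< b c

  inp : (ℕ → Bool) → Input n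
  inp b i = b (toℕ (order ⟨$⟩ˡ i))

  reach-inp : ∀ b j (j≤n : j ≤ n) → reach (inp b) j j≤n ≡ run b j j≤n
  reach-inp b zero    _   = refl
  reach-inp b (suc j) j<n = cong₂ (δ j j<n) (reach-inp b j _)
    (cong b (trans (cong toℕ (inverseˡ order)) (toℕ-fromℕ< j<n)))

  accepts-inp : ∀ b → accepts (inp b) ≡ accept (run b n ≤-refl)
  accepts-inp b = cong accept (reach-inp b n ≤-refl)

  #₁-inp : ∀ b → #₁ (inp b) ≡ ones b n
  #₁-inp b = begin
    #₁ (inp b)                            ≡⟨ #₁≡sum (inp b) ⟩
    sum {n} (bit ∘ inp b)                 ≡⟨ sum-permute (bit ∘ inp b) order ⟩
    sum {n} (bit ∘ inp b ∘ (order ⟨$⟩ʳ_))  ≡⟨ sum-cong-≗ {n} (λ _ → cong (bit ∘ b ∘ toℕ) (inverseˡ order)) ⟩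
    sum {n} (bit ∘ b ∘ toℕ)               ≡⟨ ones≡sum b n ⟨
    ones b n                              ∎
    where open ≡-Reasoning

  #₁-pad : ∀ {b j c} → j ≤ n → c ≤ n ∸ j → #₁ (inp (pad b j c)) ≡ c + ones b j
  #₁-pad {b} {j} {c} j≤n c≤n∸j = begin
    #₁ (inp (pad b j c))              ≡⟨ #₁-inp (pad b j c) ⟩
    ones (pad b j c) n                ≡⟨ cong (ones (pad b j c)) (m∸n+n≡m j≤n) ⟨
    ones (pad b j c) (n ∸ j + j)      ≡⟨ ones-pad b j c (n ∸ j) ⟩
    (n ∸ j) ⊓ c + ones b j            ≡⟨ cong (_+ ones b j) (m≥n⇒m⊓n≡n c≤n∸j) ⟩
    c + ones b j                      ∎
    where open ≡-Reasoning

module LowerBound (k : ℕ) {n} (B : OBDD n) (computes : Computes B (PartialMOD k n)) where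
  open OBDD B
  open Runs B
  open Residues k

  no-half-apart : ∀ {b b' j} (j≤n : j ≤ n) → j + W ≤ n → run b j j≤n ≡ run b' j j≤n →
                  ones b' j ≈ ones b j + h → ⊥
  no-half-apart {b} {b'} {j} j≤n j+W≤n same b'≈b+h = contradiction verdicts λ ()
    where
    c : ℕ
    c = W ∸ ones b j % W

    c≤n∸j : c ≤ n ∸ j
    c≤n∸j = ≤-trans (m∸n≤m W (ones b j % W)) (m+n≤o⇒m≤o∸n W (subst (_≤ n) (+-comm j W) j+W≤n))

    E≈0 : #₁ (inp (pad b j c)) % W ≡ 0
    E≈0 = trans (cong (_% W) (#₁-pad j≤n c≤n∸j)) (trans (complement (ones b j)) (n%n≡0 W))

    E'≈h : #₁ (inp (pad b' j c)) ≈ h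
    E'≈h = let open ≈-Reasoning in begin
      #₁ (inp (pad b' j c))  ≡⟨ #₁-pad j≤n c≤n∸j ⟩
      c + ones b' j          ≈⟨ +-cong-≈ {c} refl b'≈b+h ⟩
      c + (ones b j + h)     ≡⟨ +-assoc c _ h ⟨
      c + ones b j + h       ≈⟨ +-cong-≈ (complement (ones b j)) refl ⟩
      W + h                  ≡⟨ +-comm W h ⟩
      h + W                  ≈⟨ +W-≈ h ⟩
      h                      ∎

    verdicts : true ≡ false
    verdicts = let open ≡-Reasoning in begin
      true                               ≡⟨ proj₁ (computes _) (PartialMOD-true _ E≈0) ⟨
      accepts (inp (pad b j c))          ≡⟨ accepts-inp _ ⟩
      accept (run (pad b j c) n ≤-refl)  ≡⟨ cong accept (pad-run c j≤n j≤n ≤-refl same) ⟩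
      accept (run (pad b' j c) n ≤-refl) ≡⟨ accepts-inp _ ⟨
      accepts (inp (pad b' j c))         ≡⟨ proj₂ (computes _) (PartialMOD-false _ (trans E'≈h (m<n⇒m%n≡m h<W))) ⟩
      false                              ∎

  -- The offset o lets padding every prefix by the same number of ones keep S unchanged.
  Realises : (j : ℕ) → j ≤ n → Fin (size j) → ℕ → (ℕ → Bool) → Set
  Realises j j≤n v o S = ∀ r → r < W → S r ≡ true → ∃ λ b → run b j j≤n ≡ v × ones b j ≈ r + o

  record Realisation (j : ℕ) : Set where
    constructor realisation
    field
      j≤n      : j ≤ n
      node     : Fin (size j)
      offset   : ℕ
      residues : ℕ → Bool
      realises : Realises j j≤n node offset residues
  open Realisation

  no-half-apart-residues : ∀ {j} → j + W ≤ n → (s : Realisation j) → ∀ {x} → x < W →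
                           residues s x ≡ true → Has (residues s) (x + h) → ⊥
  no-half-apart-residues {j} j+W≤n (realisation j≤n v o S R) {x} x<W Sx Sx+h
    with b , b↦v , b≈ ← R x x<W Sx
    with b' , b'↦v , b'≈ ← R ((x + h) % W) (m%n<n (x + h) W) Sx+h
    = no-half-apart j≤n j+W≤n (trans b↦v (sym b'↦v)) (begin
      ones b' j          ≈⟨ b'≈ ⟩
      (x + h) % W + o    ≈⟨ +-cong-≈ (%-≈ (x + h)) refl ⟩
      x + h + o          ≡⟨ xy∙z≈xz∙y x h o ⟩
      x + o + h          ≈⟨ +-cong-≈ b≈ refl ⟨
      ones b j + h       ∎)
    where open ≈-Reasoning

  w : ℕ
  w = pred W

  w+1≡W : suc w ≡ W
  w+1≡W = suc-pred W

  w+j≤n : ∀ {j} → j + W ≤ n → w + j ≤ n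
  w+j≤n {j} j+W≤n = ≤-trans (+-monoˡ-≤ j pred[n]≤n) (≤-trans (≤-reflexive (+-comm W j)) j+W≤n)

  ones-pad-w : ∀ {b j a} → a ≤ w → ones (pad b j a) (w + j) ≡ a + ones b j
  ones-pad-w {b} {j} {a} a≤w = trans (ones-pad b j a w) (cong (_+ ones b j) (m≥n⇒m⊓n≡n a≤w))

  realises-∪ : ∀ {j} (s : Realisation j) (w+j≤n : w + j ≤ n) {b₀ a a'} → run b₀ j (j≤n s) ≡ node s →
               a ≤ a' → a' ≤ w → run (pad b₀ j a) (w + j) w+j≤n ≡ run (pad b₀ j a') (w + j) w+j≤n →
               Realises (w + j) w+j≤n (run (pad b₀ j a) (w + j) w+j≤n) (a + offset s)
                        (residues s ∪ (residues s +ₛ (a' ∸ a)))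
  realises-∪ {j} (realisation j≤n v o S R) w+j≤n {b₀} {a} {a'} b₀↦v a≤a' a'≤w collide r r<W r∈
    with ∪-elim {S} {S +ₛ (a' ∸ a)} r∈
  ... | inj₁ Sr with b , b↦v , b≈ ← R r r<W Sr =
    pad b j a , pad-run a (m≤n+m j w) j≤n w+j≤n (trans b↦v (sym b₀↦v)) , (begin
      ones (pad b j a) (w + j)  ≡⟨ ones-pad-w (≤-trans a≤a' a'≤w) ⟩
      a + ones b j              ≈⟨ +-cong-≈ {a} refl b≈ ⟩
      a + (r + o)               ≡⟨ x∙yz≈y∙xz a r o ⟩
      r + (a + o)               ∎)
    where open ≈-Reasoning
  ... | inj₂ Sr-d with b , b↦v , b≈ ← R ((r + (W ∸ (a' ∸ a))) % W) (m%n<n _ W) Sr-d =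
    pad b j a' , trans (pad-run a' (m≤n+m j w) j≤n w+j≤n (trans b↦v (sym b₀↦v))) (sym collide) , (begin
      ones (pad b j a') (w + j)        ≡⟨ ones-pad-w a'≤w ⟩
      a' + ones b j                    ≈⟨ +-cong-≈ {a'} refl b≈ ⟩
      a' + ((r + (W ∸ d)) % W + o)     ≈⟨ +-cong-≈ {a'} refl (+-cong-≈ (%-≈ (r + (W ∸ d))) refl) ⟩
      a' + (r + (W ∸ d) + o)           ≡⟨ cong (_+ (r + (W ∸ d) + o)) (m+[n∸m]≡n a≤a') ⟨
      a + d + (r + (W ∸ d) + o)        ≡⟨ regroup a d r (W ∸ d) o ⟩
      r + (a + o) + (d + (W ∸ d))      ≡⟨ cong (r + (a + o) +_) (m+[n∸m]≡n d≤W) ⟩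
      r + (a + o) + W                  ≈⟨ +W-≈ (r + (a + o)) ⟩
      r + (a + o)                      ∎)
    where
    open ≈-Reasoning
    d : ℕ
    d = a' ∸ a

    d≤W : d ≤ W
    d≤W = ≤-trans (m∸n≤m a' a) (≤-trans a'≤w pred[n]≤n)

    regroup : ∀ a d r e o → a + d + (r + e + o) ≡ r + (a + o) + (d + e)
    regroup = solve-∀

  size<W : width < W → ∀ {j} → j ≤ n → size j < W
  size<W narrow j≤n = ≤-<-trans (∈⇒≤foldr-⊔ (∈-map⁺ size (∈-upTo⁺ (s≤s j≤n)))) narrow

  grow-from-collision : ∀ {j} (j+W≤n : j + W ≤ n) (s : Realisation j) {r₀ b₀} → r₀ < W →
                        residues s r₀ ≡ true → run b₀ j (j≤n s) ≡ node s → ∀ {a a'} → a < a' → a' < W →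
                        run (pad b₀ j a) (w + j) (w+j≤n j+W≤n) ≡ run (pad b₀ j a') (w + j) (w+j≤n j+W≤n) →
                        Σ (Realisation (w + j)) λ s' → ones (residues s) W < ones (residues s') W
  grow-from-collision j+W≤n s {r₀} r₀<W Sr₀ b₀↦v {a} {a'} a<a' a'<W collide =
    [ (λ larger → realisation _ _ _ _ (realises-∪ s (w+j≤n j+W≤n) b₀↦v (<⇒≤ a<a') (<⇒≤pred a'<W) collide) , larger)
    , (λ shrinks → ⊥-elim (no-half-apart-residues j+W≤n s r₀<W Sr₀
                             (+h-closed d<W (closed shrinks) (m<n⇒0<n∸m a<a') r₀ (Has-< {S} r₀<W Sr₀))))
    ]′ (⊆⇒ones<⊎⊇ W λ r _ → ∪-introˡ {S} {S +ₛ d} {r})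
    where
    S : ℕ → Bool
    S = residues s

    d : ℕ
    d = a' ∸ a

    d<W : d < W
    d<W = ≤-<-trans (m∸n≤m a' a) a'<W

    closed : (S ∪ (S +ₛ d)) ⊆[ W ] S → (S +ₛ d) ⊆[ W ] S
    closed shrinks r r<W = shrinks r r<W ∘ ∪-introʳ {S} {S +ₛ d} {r}

  grow : width < W → ∀ {j} → j + W ≤ n → (s : Realisation j) → 0 < ones (residues s) W →
         Σ (Realisation (w + j)) λ s' → ones (residues s) W < ones (residues s') W
  grow narrow {j} j+W≤n s nonempty
    with r₀ , r₀<W , Sr₀ ← ones>0⇒∃ (residues s) W nonempty
    with b₀ , b₀↦v , _ ← realises s r₀ r₀<W Sr₀
    with i , i' , i<i' , collide ← pigeonhole (size<W narrow (w+j≤n j+W≤n))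
                                              (λ a → run (pad b₀ j (toℕ a)) (w + j) (w+j≤n j+W≤n))
    = grow-from-collision j+W≤n s r₀<W Sr₀ b₀↦v i<i' (toℕ<n i') collide

  realisation₀ : Realisation 0
  realisation₀ = realisation z≤n _ 0 (_<ᵇ 1) λ where
    zero    _ _  → (λ _ → false) , refl , refl
    (suc _) _ ()

  t*w+W≤n : W * W ≤ n → ∀ {t} → t ≤ W → t * w + W ≤ n
  t*w+W≤n W²≤n {t} t≤W = ≤-trans (+-monoˡ-≤ W (*-monoˡ-≤ w t≤W)) (≤-trans (≤-reflexive W*w+W≡W²) W²≤n)
    where
    W*w+W≡W² : W * w + W ≡ W * W
    W*w+W≡W² = trans (+-comm (W * w) W) (trans (sym (*-suc W w)) (cong (W *_) w+1≡W))

  many-residues : width < W → W * W ≤ n → ∀ t → t ≤ W → Σ (Realisation (t * w)) λ s → t < ones (residues s) W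
  many-residues narrow W²≤n zero _ = realisation₀ , ≤-reflexive (sym one-residue)
    where
    one-residue : ones (_<ᵇ 1) W ≡ 1
    one-residue = trans (ones-<ᵇ 1 W) (m≥n⇒m⊓n≡n (m^n>0 2 (suc k)))
  many-residues narrow W²≤n (suc t) t<W =
    let s , t<|S| = many-residues narrow W²≤n t (<⇒≤ t<W)
        s' , |S|<|S'| = grow narrow (t*w+W≤n W²≤n (<⇒≤ t<W)) s (≤-<-trans z≤n t<|S|)
    in s' , ≤-<-trans t<|S| |S|<|S'|

  width≥W : W * W ≤ n → W ≤ width
  width≥W W²≤n with W ≤? width
  ... | yes W≤width = W≤width
  ... | no  W≰width =
    let s , W<|S| = many-residues (≰⇒> W≰width) W²≤n W ≤-refl
    in contradiction (ones≤ (residues s) W) (<⇒≱ W<|S|)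

theorem2 : (k : ℕ) → (m : ℕ) → Σ ℕ (λ n → (m ≤ n) × ((B : OBDD n) → Computes B (PartialMOD k n) → 2 ^ suc k ≤ OBDD.width B))
theorem2 k m = m + W * W , m≤m+n m (W * W) , λ B computes → LowerBound.width≥W k B computes (m≤n+m (W * W) m)
  where open Residues k
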